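{- Let $X=\{x,y\}$ be a set of cardinality two, $f\in\mathrm{Bool}(X)$ and $(q_1,q_2)\in\mathbb{Z}^2$. Then $f$ is $(q_1,q_2)$-indecomposable if and only if \[f(\{x,y\})\neq q_1f(\{x\})+q_2f(\{y\})\quad\text{and}\quad f(\{x,y\})\neq q_1f(\{y\})+q_2f(\{x\}).\]
   Context: A boolean function on a finite set $X$ is a map $f:\mathcal{P}(X)\to\mathbb{Z}$ with $f(\emptyset)=0$; $\mathrm{Bool}(X)$ is the set of them. For disjoint finite sets $X,Y$, $f\in\mathrm{Bool}(X)$, $g\in\mathrm{Bool}(Y)$, the product $f\star_{q_1,q_2}g\in\mathrm{Bool}(X\sqcup Y)$ is $f\star_{q_1,q_2}g(A)=q_1^{|A\cap Y|}f(A\cap X)+q_2^{|A\cap X|}g(A\cap Y)$ (with $0^0=1$). For a nonempty finite set $X$, $f\in\mathrm{Bool}(X)$ is $(q_1,q_2)$-indecomposable if for every $Y\subseteq X$, $f'\in\mathrm{Bool}(X\setminus Y)$, $f''\in\mathrm{Bool}(Y)$, the equality $f=f'\star_{q_1,q_2}f''$ implies $Y=\emptyset$ or $Y=X$. -}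

module Defs where

open import Data.Nat using (ℕ)
open import Data.Integer using (ℤ; _+_; _*_; _^_; 0ℤ)
open import Data.Fin.Subset using (Subset; ⊥; _∩_; _─_; _⊆_; ∣_∣)
open import Data.Sum using (_⊎_)
open import Relation.Binary.PropositionalEquality using (_≡_)

-- Finite sets are modelled as subsets X of an ambient universe Fin n.
-- A function Subset n → ℤ is regarded as an element of Bool(X) when it
-- vanishes on the empty set; only its values on subsets of X matter.
IsBool : ∀ {n} → (Subset n → ℤ) → Set
IsBool f = f ⊥ ≡ 0ℤ

-- The product f ⋆_{q1,q2} g for (disjoint) X, Y :
-- (f ⋆ g)(A) = q1^|A∩Y| f(A∩X) + q2^|A∩X| g(A∩Y).   (Data.Integer._^_ has 0^0 = 1.)
star : ∀ {n} → ℤ → ℤ → (X Y : Subset n) →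
       (Subset n → ℤ) → (Subset n → ℤ) → Subset n → ℤ
star q₁ q₂ X Y f g A = (q₁ ^ ∣ A ∩ Y ∣) * f (A ∩ X) + (q₂ ^ ∣ A ∩ X ∣) * g (A ∩ Y)

Indecomposable : ∀ {n} → ℤ → ℤ → (X : Subset n) → (Subset n → ℤ) → Set
Indecomposable q₁ q₂ X f =
  ∀ (Y : Subset _) → Y ⊆ X →
  ∀ (f′ f″ : Subset _ → ℤ) → IsBool f′ → IsBool f″ →
  (∀ A → A ⊆ X → f A ≡ star q₁ q₂ (X ─ Y) Y f′ f″ A) →
  (Y ≡ ⊥) ⊎ (Y ≡ X)

{-# OPTIONS --safe #-}
module Submission where

-- A subset Y of X = {x, y} is ∅, {x}, {y} or X.  For Y = {y} the product f′ ⋆ f″ restricted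
-- to 𝒫(X) takes the values 0, f′{x}, f″{y} and q₁ f′{x} + q₂ f″{y}; so f splits off {y}
-- exactly when f(X) = q₁ f{x} + q₂ f{y}, and then f′ = f″ = f is a splitting.  The case
-- Y = {x} is the same with x and y exchanged.

open import Defs
open import Data.Nat using (ℕ)
open import Data.Fin using (Fin)
open import Data.Fin.Subset using (Subset; ⁅_⁆; _∪_)
open import Data.Integer using (ℤ; _+_; _*_)
open import Data.Product using (_×_)
open import Function.Bundles using (_⇔_)
open import Relation.Binary.PropositionalEquality using (_≡_; _≢_)

open import Data.Bool using (true; false)
open import Data.Integer using (_^_; 0ℤ; 1ℤ)
open import Data.Empty using (⊥-elim)
open import Data.Fin.Subset using (⊥; _∩_; _─_; _⊆_; _∈_; ∣_∣)
open import Data.Fin.Subset.Properties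
  using ( _∈?_; Empty-unique; ∉⊥; ⊥⊆; ∣⊥∣≡0; x∈⁅x⁆; x∈⁅y⁆⇒x≡y; ∣⁅x⁆∣≡1
        ; ⊆-refl; ⊆-antisym; ∩-comm; ∩-zeroˡ; p∩q⊆p; x∈p∩q⁺; x∈p∩q⁻
        ; ∪-comm; p⊆p∪q; q⊆p∪q; x∈p∪q⁻ )
open import Data.Integer.Properties using (*-identityˡ; *-zeroʳ; +-identityʳ; +-identityˡ; ^-identityʳ)
open import Data.Product using (∃₂; _,_)
open import Data.Sum using (_⊎_; inj₁; inj₂; [_,_]′)
open import Data.Vec using ([]; _∷_; tail)
open import Function using (_∘_; const)
open import Function.Bundles using (mk⇔; Equivalence)
open import Relation.Nullary using (yes; no)
open import Relation.Binary.PropositionalEquality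
  using (refl; sym; trans; cong; cong₂; subst; module ≡-Reasoning)

private
  variable
    n : ℕ
    x y : Fin n
    p q r : Subset n

⁅x⁆⊆p : x ∈ p → ⁅ x ⁆ ⊆ p
⁅x⁆⊆p {p = p} x∈p z∈⁅x⁆ = subst (_∈ p) (sym (x∈⁅y⁆⇒x≡y _ z∈⁅x⁆)) x∈p

∪-least : p ⊆ r → q ⊆ r → p ∪ q ⊆ r
∪-least {p = p} {q = q} p⊆r q⊆r z∈p∪q = [ p⊆r , q⊆r ]′ (x∈p∪q⁻ p q z∈p∪q)

p⊆q⇒p∩q≡p : p ⊆ q → p ∩ q ≡ p
p⊆q⇒p∩q≡p {p = p} {q = q} p⊆q = ⊆-antisym (p∩q⊆p p q) (λ z∈p → x∈p∩q⁺ (z∈p , p⊆q z∈p))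

⁅x⁆∩⁅y⁆≡⊥ : x ≢ y → ⁅ x ⁆ ∩ ⁅ y ⁆ ≡ ⊥
⁅x⁆∩⁅y⁆≡⊥ {x = x} {y = y} x≢y = Empty-unique λ (z , z∈⁅x⁆∩⁅y⁆) →
  let (z∈⁅x⁆ , z∈⁅y⁆) = x∈p∩q⁻ ⁅ x ⁆ ⁅ y ⁆ z∈⁅x⁆∩⁅y⁆
  in x≢y (trans (sym (x∈⁅y⁆⇒x≡y x z∈⁅x⁆)) (x∈⁅y⁆⇒x≡y y z∈⁅y⁆))

p∪q─q≡p : ∀ (p q : Subset n) → p ∩ q ≡ ⊥ → (p ∪ q) ─ q ≡ p
p∪q─q≡p []          []          _    = refl
p∪q─q≡p (true ∷ p)  (true ∷ q)  ()
p∪q─q≡p (true ∷ p)  (false ∷ q) disj = cong (true ∷_) (p∪q─q≡p p q (cong tail disj))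
p∪q─q≡p (false ∷ p) (true ∷ q)  disj = cong (false ∷_) (p∪q─q≡p p q (cong tail disj))
p∪q─q≡p (false ∷ p) (false ∷ q) disj = cong (false ∷_) (p∪q─q≡p p q (cong tail disj))

⊆⁅x⁆∪⁅y⁆-by-points : p ⊆ ⁅ x ⁆ ∪ ⁅ y ⁆ → (x ∈ p → x ∈ q) → (y ∈ p → y ∈ q) → p ⊆ q
⊆⁅x⁆∪⁅y⁆-by-points {x = x} {y = y} p⊆xy x∈q y∈q z∈p with x∈p∪q⁻ ⁅ x ⁆ ⁅ y ⁆ (p⊆xy z∈p)
... | inj₁ z∈⁅x⁆ rewrite x∈⁅y⁆⇒x≡y x z∈⁅x⁆ = x∈q z∈p
... | inj₂ z∈⁅y⁆ rewrite x∈⁅y⁆⇒x≡y y z∈⁅y⁆ = y∈q z∈p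

⊆⁅x⁆∪⁅y⁆ : p ⊆ ⁅ x ⁆ ∪ ⁅ y ⁆ →
  (p ≡ ⊥) ⊎ (p ≡ ⁅ x ⁆) ⊎ (p ≡ ⁅ y ⁆) ⊎ (p ≡ ⁅ x ⁆ ∪ ⁅ y ⁆)
⊆⁅x⁆∪⁅y⁆ {p = p} {x = x} {y = y} p⊆xy with x ∈? p | y ∈? p
... | no x∉p  | no y∉p  =
  inj₁ (⊆-antisym (⊆⁅x⁆∪⁅y⁆-by-points p⊆xy (⊥-elim ∘ x∉p) (⊥-elim ∘ y∉p)) ⊥⊆)
... | yes x∈p | no y∉p  =
  inj₂ (inj₁ (⊆-antisym (⊆⁅x⁆∪⁅y⁆-by-points p⊆xy (const (x∈⁅x⁆ x)) (⊥-elim ∘ y∉p)) (⁅x⁆⊆p x∈p)))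
... | no x∉p  | yes y∈p =
  inj₂ (inj₂ (inj₁ (⊆-antisym (⊆⁅x⁆∪⁅y⁆-by-points p⊆xy (⊥-elim ∘ x∉p) (const (x∈⁅x⁆ y))) (⁅x⁆⊆p y∈p))))
... | yes x∈p | yes y∈p =
  inj₂ (inj₂ (inj₂ (⊆-antisym p⊆xy (∪-least (⁅x⁆⊆p x∈p) (⁅x⁆⊆p y∈p)))))

⁅x⁆≢⊥ : ⁅ x ⁆ ≢ ⊥
⁅x⁆≢⊥ {x = x} ⁅x⁆≡⊥ = ∉⊥ (subst (x ∈_) ⁅x⁆≡⊥ (x∈⁅x⁆ x))

⁅y⁆≢⁅x⁆∪⁅y⁆ : x ≢ y → ⁅ y ⁆ ≢ ⁅ x ⁆ ∪ ⁅ y ⁆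
⁅y⁆≢⁅x⁆∪⁅y⁆ {x = x} {y = y} x≢y ⁅y⁆≡⁅x⁆∪⁅y⁆ =
  x≢y (x∈⁅y⁆⇒x≡y y (subst (x ∈_) (sym ⁅y⁆≡⁅x⁆∪⁅y⁆) (p⊆p∪q ⁅ y ⁆ (x∈⁅x⁆ x))))

⁅x⁆≢⁅x⁆∪⁅y⁆ : x ≢ y → ⁅ x ⁆ ≢ ⁅ x ⁆ ∪ ⁅ y ⁆
⁅x⁆≢⁅x⁆∪⁅y⁆ {x = x} {y = y} x≢y rewrite ∪-comm ⁅ x ⁆ ⁅ y ⁆ = ⁅y⁆≢⁅x⁆∪⁅y⁆ (x≢y ∘ sym)

module _ (q₁ q₂ : ℤ) (f g : Subset n → ℤ) where
  open ≡-Reasoning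

  star-on-left : IsBool g → ∀ {A P Q} → A ⊆ P → A ∩ Q ≡ ⊥ → star q₁ q₂ P Q f g A ≡ f A
  star-on-left g-bool {A} {P} {Q} A⊆P A∩Q≡⊥ = begin
    q₁ ^ ∣ A ∩ Q ∣ * f (A ∩ P) + q₂ ^ ∣ A ∩ P ∣ * g (A ∩ Q)
      ≡⟨ cong₂ (λ B C → q₁ ^ ∣ B ∣ * f C + q₂ ^ ∣ C ∣ * g B) A∩Q≡⊥ (p⊆q⇒p∩q≡p A⊆P) ⟩
    q₁ ^ ∣ ⊥ {n} ∣ * f A + q₂ ^ ∣ A ∣ * g ⊥
      ≡⟨ cong₂ (λ k v → q₁ ^ k * f A + q₂ ^ ∣ A ∣ * v) (∣⊥∣≡0 n) g-bool ⟩
    1ℤ * f A + q₂ ^ ∣ A ∣ * 0ℤ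
      ≡⟨ cong₂ _+_ (*-identityˡ (f A)) (*-zeroʳ (q₂ ^ ∣ A ∣)) ⟩
    f A + 0ℤ
      ≡⟨ +-identityʳ (f A) ⟩
    f A ∎

  star-on-right : IsBool f → ∀ {A P Q} → A ⊆ Q → A ∩ P ≡ ⊥ → star q₁ q₂ P Q f g A ≡ g A
  star-on-right f-bool {A} {P} {Q} A⊆Q A∩P≡⊥ = begin
    q₁ ^ ∣ A ∩ Q ∣ * f (A ∩ P) + q₂ ^ ∣ A ∩ P ∣ * g (A ∩ Q)
      ≡⟨ cong₂ (λ B C → q₁ ^ ∣ C ∣ * f B + q₂ ^ ∣ B ∣ * g C) A∩P≡⊥ (p⊆q⇒p∩q≡p A⊆Q) ⟩
    q₁ ^ ∣ A ∣ * f ⊥ + q₂ ^ ∣ ⊥ {n} ∣ * g A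
      ≡⟨ cong₂ (λ v k → q₁ ^ ∣ A ∣ * v + q₂ ^ k * g A) f-bool (∣⊥∣≡0 n) ⟩
    q₁ ^ ∣ A ∣ * 0ℤ + 1ℤ * g A
      ≡⟨ cong₂ _+_ (*-zeroʳ (q₁ ^ ∣ A ∣)) (*-identityˡ (g A)) ⟩
    0ℤ + g A
      ≡⟨ +-identityˡ (g A) ⟩
    g A ∎

  star-on-∪ : ∀ P Q → star q₁ q₂ P Q f g (P ∪ Q) ≡ q₁ ^ ∣ Q ∣ * f P + q₂ ^ ∣ P ∣ * g Q
  star-on-∪ P Q = cong₂ (λ B C → q₁ ^ ∣ B ∣ * f C + q₂ ^ ∣ C ∣ * g B) (∪∩≡ (q⊆p∪q P Q)) (∪∩≡ (p⊆p∪q Q))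
    where
    ∪∩≡ : ∀ {R} → R ⊆ P ∪ Q → (P ∪ Q) ∩ R ≡ R
    ∪∩≡ {R} R⊆P∪Q = trans (∩-comm (P ∪ Q) R) (p⊆q⇒p∩q≡p R⊆P∪Q)

  star-⁅x⁆⁅y⁆-on-∪ : (x y : Fin n) →
    star q₁ q₂ ⁅ x ⁆ ⁅ y ⁆ f g (⁅ x ⁆ ∪ ⁅ y ⁆) ≡ q₁ * f ⁅ x ⁆ + q₂ * g ⁅ y ⁆
  star-⁅x⁆⁅y⁆-on-∪ x y = begin
    star q₁ q₂ ⁅ x ⁆ ⁅ y ⁆ f g (⁅ x ⁆ ∪ ⁅ y ⁆)
      ≡⟨ star-on-∪ ⁅ x ⁆ ⁅ y ⁆ ⟩
    q₁ ^ ∣ ⁅ y ⁆ ∣ * f ⁅ x ⁆ + q₂ ^ ∣ ⁅ x ⁆ ∣ * g ⁅ y ⁆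
      ≡⟨ cong₂ (λ k l → q₁ ^ k * f ⁅ x ⁆ + q₂ ^ l * g ⁅ y ⁆) (∣⁅x⁆∣≡1 y) (∣⁅x⁆∣≡1 x) ⟩
    q₁ ^ 1 * f ⁅ x ⁆ + q₂ ^ 1 * g ⁅ y ⁆
      ≡⟨ cong₂ (λ a b → a * f ⁅ x ⁆ + b * g ⁅ y ⁆) (^-identityʳ q₁) (^-identityʳ q₂) ⟩
    q₁ * f ⁅ x ⁆ + q₂ * g ⁅ y ⁆ ∎

SplitsOff : ℤ → ℤ → (X Y : Subset n) → (Subset n → ℤ) → Set
SplitsOff q₁ q₂ X Y f =
  ∃₂ λ f′ f″ → IsBool f′ × IsBool f″ × (∀ A → A ⊆ X → f A ≡ star q₁ q₂ (X ─ Y) Y f′ f″ A)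

module _ (q₁ q₂ : ℤ) {x y : Fin n} (x≢y : x ≢ y) {f : Subset n → ℤ} where

  private
    rebase : ∀ f′ f″ A →
      star q₁ q₂ (⁅ x ⁆ ∪ ⁅ y ⁆ ─ ⁅ y ⁆) ⁅ y ⁆ f′ f″ A ≡ star q₁ q₂ ⁅ x ⁆ ⁅ y ⁆ f′ f″ A
    rebase f′ f″ A =
      cong (λ P → star q₁ q₂ P ⁅ y ⁆ f′ f″ A) (p∪q─q≡p ⁅ x ⁆ ⁅ y ⁆ (⁅x⁆∩⁅y⁆≡⊥ x≢y))

  f≡f⋆f : IsBool f → f (⁅ x ⁆ ∪ ⁅ y ⁆) ≡ q₁ * f ⁅ x ⁆ + q₂ * f ⁅ y ⁆ →
    ∀ A → A ⊆ ⁅ x ⁆ ∪ ⁅ y ⁆ → f A ≡ star q₁ q₂ ⁅ x ⁆ ⁅ y ⁆ f f A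
  f≡f⋆f f-bool f-on-∪ A A⊆X with ⊆⁅x⁆∪⁅y⁆ A⊆X
  ... | inj₁ refl                = sym (star-on-left q₁ q₂ f f f-bool ⊥⊆ (∩-zeroˡ ⁅ y ⁆))
  ... | inj₂ (inj₁ refl)         = sym (star-on-left q₁ q₂ f f f-bool ⊆-refl (⁅x⁆∩⁅y⁆≡⊥ x≢y))
  ... | inj₂ (inj₂ (inj₁ refl))  = sym (star-on-right q₁ q₂ f f f-bool ⊆-refl (⁅x⁆∩⁅y⁆≡⊥ (x≢y ∘ sym)))
  ... | inj₂ (inj₂ (inj₂ refl))  = trans f-on-∪ (sym (star-⁅x⁆⁅y⁆-on-∪ q₁ q₂ f f x y))

  splitsOff⁅y⁆⇔ : IsBool f →
    SplitsOff q₁ q₂ (⁅ x ⁆ ∪ ⁅ y ⁆) ⁅ y ⁆ f ⇔ (f (⁅ x ⁆ ∪ ⁅ y ⁆) ≡ q₁ * f ⁅ x ⁆ + q₂ * f ⁅ y ⁆)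
  splitsOff⁅y⁆⇔ f-bool = mk⇔ to from
    where
    open ≡-Reasoning

    to : SplitsOff q₁ q₂ (⁅ x ⁆ ∪ ⁅ y ⁆) ⁅ y ⁆ f → f (⁅ x ⁆ ∪ ⁅ y ⁆) ≡ q₁ * f ⁅ x ⁆ + q₂ * f ⁅ y ⁆
    to (f′ , f″ , f′-bool , f″-bool , f≡f′⋆f″) = begin
      f (⁅ x ⁆ ∪ ⁅ y ⁆)                ≡⟨ f≡⋆ (⁅ x ⁆ ∪ ⁅ y ⁆) ⊆-refl ⟩
      star q₁ q₂ ⁅ x ⁆ ⁅ y ⁆ f′ f″ (⁅ x ⁆ ∪ ⁅ y ⁆) ≡⟨ star-⁅x⁆⁅y⁆-on-∪ q₁ q₂ f′ f″ x y ⟩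
      q₁ * f′ ⁅ x ⁆ + q₂ * f″ ⁅ y ⁆      ≡⟨ cong₂ (λ u v → q₁ * u + q₂ * v) f⁅x⁆≡f′⁅x⁆ f⁅y⁆≡f″⁅y⁆ ⟨
      q₁ * f ⁅ x ⁆ + q₂ * f ⁅ y ⁆        ∎
      where
      f≡⋆ : ∀ A → A ⊆ ⁅ x ⁆ ∪ ⁅ y ⁆ → f A ≡ star q₁ q₂ ⁅ x ⁆ ⁅ y ⁆ f′ f″ A
      f≡⋆ A A⊆X = trans (f≡f′⋆f″ A A⊆X) (rebase f′ f″ A)
      f⁅x⁆≡f′⁅x⁆ : f ⁅ x ⁆ ≡ f′ ⁅ x ⁆
      f⁅x⁆≡f′⁅x⁆ = trans (f≡⋆ ⁅ x ⁆ (p⊆p∪q ⁅ y ⁆)) (star-on-left q₁ q₂ f′ f″ f″-bool ⊆-refl (⁅x⁆∩⁅y⁆≡⊥ x≢y))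
      f⁅y⁆≡f″⁅y⁆ : f ⁅ y ⁆ ≡ f″ ⁅ y ⁆
      f⁅y⁆≡f″⁅y⁆ = trans (f≡⋆ ⁅ y ⁆ (q⊆p∪q ⁅ x ⁆ ⁅ y ⁆)) (star-on-right q₁ q₂ f′ f″ f′-bool ⊆-refl (⁅x⁆∩⁅y⁆≡⊥ (x≢y ∘ sym)))

    from : f (⁅ x ⁆ ∪ ⁅ y ⁆) ≡ q₁ * f ⁅ x ⁆ + q₂ * f ⁅ y ⁆ → SplitsOff q₁ q₂ (⁅ x ⁆ ∪ ⁅ y ⁆) ⁅ y ⁆ f
    from f-on-∪ = f , f , f-bool , f-bool ,
      λ A A⊆X → trans (f≡f⋆f f-bool f-on-∪ A A⊆X) (sym (rebase f f A))

splitsOff⁅x⁆⇔ : (q₁ q₂ : ℤ) → x ≢ y → {f : Subset n → ℤ} → IsBool f →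
  SplitsOff q₁ q₂ (⁅ x ⁆ ∪ ⁅ y ⁆) ⁅ x ⁆ f ⇔ (f (⁅ x ⁆ ∪ ⁅ y ⁆) ≡ q₁ * f ⁅ y ⁆ + q₂ * f ⁅ x ⁆)
splitsOff⁅x⁆⇔ {x = x} {y = y} q₁ q₂ x≢y f-bool rewrite ∪-comm ⁅ x ⁆ ⁅ y ⁆ =
  splitsOff⁅y⁆⇔ q₁ q₂ (x≢y ∘ sym) f-bool

proposition2p6 : ∀ {n : ℕ} (x y : Fin n) → x ≢ y →
    (f : Subset n → ℤ) → IsBool f → (q₁ q₂ : ℤ) →
    Indecomposable q₁ q₂ (⁅ x ⁆ ∪ ⁅ y ⁆) f ⇔
      ((f (⁅ x ⁆ ∪ ⁅ y ⁆) ≢ q₁ * f ⁅ x ⁆ + q₂ * f ⁅ y ⁆) ×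
       (f (⁅ x ⁆ ∪ ⁅ y ⁆) ≢ q₁ * f ⁅ y ⁆ + q₂ * f ⁅ x ⁆))
proposition2p6 x y x≢y f f-bool q₁ q₂ = mk⇔ to from
  where
  X : Subset _
  X = ⁅ x ⁆ ∪ ⁅ y ⁆

  splits-trivially : Indecomposable q₁ q₂ X f → ∀ Y → Y ⊆ X → SplitsOff q₁ q₂ X Y f → (Y ≡ ⊥) ⊎ (Y ≡ X)
  splits-trivially indec Y Y⊆X (f′ , f″ , f′-bool , f″-bool , f≡f′⋆f″) =
    indec Y Y⊆X f′ f″ f′-bool f″-bool f≡f′⋆f″

  to : Indecomposable q₁ q₂ X f →
    (f X ≢ q₁ * f ⁅ x ⁆ + q₂ * f ⁅ y ⁆) × (f X ≢ q₁ * f ⁅ y ⁆ + q₂ * f ⁅ x ⁆)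
  to indec =
    (λ f-on-X → [ ⁅x⁆≢⊥ , ⁅y⁆≢⁅x⁆∪⁅y⁆ x≢y ]′ (splits-trivially indec ⁅ y ⁆ (q⊆p∪q ⁅ x ⁆ ⁅ y ⁆)
                  (Equivalence.from (splitsOff⁅y⁆⇔ q₁ q₂ x≢y f-bool) f-on-X))) ,
    (λ f-on-X → [ ⁅x⁆≢⊥ , ⁅x⁆≢⁅x⁆∪⁅y⁆ x≢y ]′ (splits-trivially indec ⁅ x ⁆ (p⊆p∪q ⁅ y ⁆)
                  (Equivalence.from (splitsOff⁅x⁆⇔ q₁ q₂ x≢y f-bool) f-on-X)))

  from : (f X ≢ q₁ * f ⁅ x ⁆ + q₂ * f ⁅ y ⁆) × (f X ≢ q₁ * f ⁅ y ⁆ + q₂ * f ⁅ x ⁆) →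
    Indecomposable q₁ q₂ X f
  from (≢⁅y⁆-split , ≢⁅x⁆-split) Y Y⊆X f′ f″ f′-bool f″-bool f≡f′⋆f″ with ⊆⁅x⁆∪⁅y⁆ Y⊆X
  ... | inj₁ Y≡⊥                = inj₁ Y≡⊥
  ... | inj₂ (inj₁ refl)        = ⊥-elim (≢⁅x⁆-split (Equivalence.to (splitsOff⁅x⁆⇔ q₁ q₂ x≢y f-bool)
                                    (f′ , f″ , f′-bool , f″-bool , f≡f′⋆f″)))
  ... | inj₂ (inj₂ (inj₁ refl)) = ⊥-elim (≢⁅y⁆-split (Equivalence.to (splitsOff⁅y⁆⇔ q₁ q₂ x≢y f-bool)
                                    (f′ , f″ , f′-bool , f″-bool , f≡f′⋆f″)))
  ... | inj₂ (inj₂ (inj₂ Y≡X))  = inj₂ Y≡X
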